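{- If $H$ is a graph on $k$ nodes with $\binom{k}{2}-\epsilon$ edges, then $\tau(H)\le\big\lceil \frac12+\sqrt{\epsilon/2}\,\big\rceil$.
   Context: For a dag $P$: $S_P$ its sources; $V_P(u)$ the set of nodes reachable from $u$ (including $u$); $V_P(B)=\bigcup_{u\in B}V_P(u)$. A dag tree decomposition of $P$ is a rooted tree whose nodes (bags) are subsets of $S_P$ with union $S_P$, such that whenever bag $B$ lies on the tree path between bags $B_1,B_2$, $V_P(B_1)\cap V_P(B_2)\subseteq V_P(B)$; width = max bag size; $\tau(P)$ = minimum width. For undirected $H$: $\tau_1(H)=\max\tau(P)$ over acyclic orientations $P$ of $H$; $\tau_2(H)=\max\tau_1(H/\theta)$ over equivalence relations $\theta$ on $V_H$ ($H/\theta$: identify equivalent nodes, remove loops and multi-edges); $\tau(H)=\max\tau_2(H')$ over all graphs $H'$ on $V_H$ with $E_{H'}\supseteq E_H$. -}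

module Defs where

open import Data.Nat using (ℕ; zero; suc; _+_; _*_; _∸_; _^_; _≤_; _<ᵇ_)
open import Data.Nat.Combinatorics using (_C_)
open import Data.Bool using (Bool; true; false; _∧_; if_then_else_)
open import Data.Fin using (Fin; toℕ)
open import Data.Fin.Subset using (Subset; _∈_; ∣_∣)
open import Data.List using (List; map; allFin)
open import Data.Nat.ListAction using (sum)
open import Data.Product using (Σ; ∃; ∃-syntax; _×_)
open import Data.Sum using (_⊎_)
open import Relation.Nullary using (¬_)
open import Relation.Binary.PropositionalEquality using (_≡_; _≢_)
open import Relation.Binary.Construct.Closure.ReflexiveTransitive using (Star)
open import Function.Definitions using (Surjective)

record Graph (k : ℕ) : Set where
  field
    adj   : Fin k → Fin k → Bool
    sym   : ∀ u v → adj u v ≡ adj v u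
    irrefl : ∀ u → adj u u ≡ false
open Graph public

edgeCount : ∀ {k} → Graph k → ℕ
edgeCount {k} H =
  sum (map (λ i → sum (map (λ j → if (toℕ i <ᵇ toℕ j) ∧ adj H i j then 1 else 0)
                           (allFin k)))
           (allFin k))

_⊆ᴱ_ : ∀ {k} → Graph k → Graph k → Set
H ⊆ᴱ H' = ∀ u v → adj H u v ≡ true → adj H' u v ≡ true

-- An equivalence relation θ on Fin k is represented by
-- the surjective class map  f : Fin k → Fin n  (Fin n = the classes).

QuotAdj : ∀ {k n} → Graph k → (Fin k → Fin n) → Fin n → Fin n → Set
QuotAdj H f a b = a ≢ b × ∃[ u ] ∃[ v ] (f u ≡ a × f v ≡ b × adj H u v ≡ true)

Reach : ∀ {n} → (Fin n → Fin n → Set) → Fin n → Fin n → Set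
Reach D = Star D

Acyclic : ∀ {n} → (Fin n → Fin n → Set) → Set
Acyclic D = ∀ a b → D a b → ¬ Reach D b a

IsAcyclicOrientation : ∀ {n} → (Fin n → Fin n → Set) → (Fin n → Fin n → Set) → Set
IsAcyclicOrientation E D =
  (∀ a b → D a b → E a b) ×
  (∀ a b → E a b → D a b ⊎ D b a) ×
  Acyclic D

IsSource : ∀ {n} → (Fin n → Fin n → Set) → Fin n → Set
IsSource D a = ∀ b → ¬ D b a

InReachSet : ∀ {n} → (Fin n → Fin n → Set) → Subset n → Fin n → Set
InReachSet D B v = ∃[ u ] (u ∈ B × Reach D u v)

-- Finite rooted trees: nodes Fin (suc size), root = zero, and node (suc i)
-- has parent (parent i) whose index is at most i (every finite rooted tree
-- admits such a numbering, e.g. BFS order).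

record RootedTree : Set where
  field
    size      : ℕ
    parent    : Fin size → Fin (suc size)
    parent-lt : ∀ i → toℕ (parent i) ≤ toℕ i

  Node : Set
  Node = Fin (suc size)

  ParentOf : Node → Node → Set
  ParentOf x y = ∃[ i ] (y ≡ Fin.suc i × x ≡ parent i)

  AncOrSelf : Node → Node → Set
  AncOrSelf = Star ParentOf

  -- x lies on the (unique) tree path between y and z: the path goes up from
  -- y to lca(y,z) and down to z, i.e. x is an ancestor-or-self of y or of z
  -- and lca(y,z) (equivalently every common ancestor) is an ancestor-or-self of x.
  OnPath : Node → Node → Node → Set
  OnPath x y z =
    (AncOrSelf x y ⊎ AncOrSelf x z) ×
    (∀ w → AncOrSelf w y → AncOrSelf w z → AncOrSelf w x)
open RootedTree public

record DagTreeDecomposition {n : ℕ} (D : Fin n → Fin n → Set) : Set₁ where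
  field
    tree      : RootedTree
    bag       : Node tree → Subset n
    bag⊆S     : ∀ x u → u ∈ bag x → IsSource D u
    S⊆⋃bags   : ∀ u → IsSource D u → ∃[ x ] (u ∈ bag x)
    path-cond : ∀ x y z → OnPath tree x y z →
                ∀ v → InReachSet D (bag y) v → InReachSet D (bag z) v →
                InReachSet D (bag x) v

width≤ : ∀ {n} {D : Fin n → Fin n → Set} → DagTreeDecomposition D → ℕ → Set
width≤ T m = ∀ x → ∣ DagTreeDecomposition.bag T x ∣ ≤ m

τ-dag≤ : ∀ {n} → (Fin n → Fin n → Set) → ℕ → Set₁
τ-dag≤ D m = Σ (DagTreeDecomposition D) (λ T → width≤ T m)

-- τ(H) ≤ m, unfolding the three maxima:
-- for every H' ⊇ H on V_H, every equivalence θ (as surjective class map f),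
-- every acyclic orientation P of H'/θ : τ(P) ≤ m.
τ-graph≤ : ∀ {k} → Graph k → ℕ → Set₁
τ-graph≤ {k} H m =
  ∀ (H' : Graph k) → H ⊆ᴱ H' →
  ∀ (n : ℕ) (f : Fin k → Fin n) → Surjective _≡_ _≡_ f →
  ∀ (D : Fin n → Fin n → Set) → IsAcyclicOrientation (QuotAdj H' f) D →
  τ-dag≤ D m

module Submission where

open import Defs
open import Data.Nat using (ℕ; _+_; _*_; _∸_; _^_; _≤_)
open import Data.Nat.Combinatorics using (_C_)
open import Relation.Binary.PropositionalEquality using (_≡_)

open import Data.Nat using (zero; suc; _<_; _<ᵇ_; z≤n; s≤s; _≤?_)
open import Data.Nat.Properties
open import Data.Nat.Combinatorics using (nCk+nC[k+1]≡[n+1]C[k+1]; nC1≡n)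
open import Data.Nat.Tactic.RingSolver using (solve-∀)
open import Data.Nat.ListAction using () renaming (sum to listSum)
open import Data.Bool using (Bool; true; false; _∧_; if_then_else_)
open import Data.Bool.Properties using () renaming (_≟_ to _≟ᵇ_)
open import Data.Fin using (Fin; toℕ; punchIn) renaming (_≟_ to _≟ᶠ_)
open import Data.Fin.Properties using (any?; all?; punchInᵢ≢i)
open import Data.Fin.Subset using (Subset; _∈_; ∣_∣)
open import Data.Vec using ([]; _∷_; tabulate)
open import Data.Vec.Base using (here; there)
open import Data.Vec.Properties using (lookup∘tabulate; []=⇒lookup; lookup⇒[]=)
open import Data.List using (map; allFin)
import Data.List as List
open import Data.Product using (∃-syntax; _×_; _,_; proj₁; proj₂)
open import Data.Sum using (_⊎_; inj₁; inj₂; [_,_]′)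
import Data.Sum
open import Data.Empty using (⊥; ⊥-elim)
open import Relation.Nullary using (¬_; Dec; yes; no; does)
open import Relation.Nullary.Decidable using (_×-dec_; ¬?; dec-true)
open import Relation.Binary.PropositionalEquality
  using (_≢_; refl; trans; cong; cong₂; subst; subst₂; module ≡-Reasoning)
  renaming (sym to ≡-sym)
open import Relation.Binary.Construct.Closure.ReflexiveTransitive using (_◅_) renaming (ε to []ᴿ)
open import Function using (_∘_; id)
open import Function.Definitions using (Surjective)
open import Algebra.Properties.CommutativeMonoid.Sum +-0-commutativeMonoid
  using (sum; sum-cong-≗; sum-remove; sum-replicate-zero; ∑-distrib-+; ∑-comm)

-- Fix H' ⊇ H, a quotient H'/θ (given by a surjective class map f with a
-- section `rep`) and an acyclic orientation D of H'/θ.  If two source classes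
-- had H-adjacent representatives, the corresponding quotient edge would be
-- oriented into one of them, so the representatives of the source classes
-- form an independent set of H.  An independent set with s nodes accounts for
-- C(s,2) missing edges, hence C(s,2) ≤ ε, which together with
-- 2ε ≤ (2m-1)² forces s ≤ 2m.  Finally any dag with at most 2m sources has a
-- dag tree decomposition of width m: a tree with two nodes whose bags split
-- the sources into halves; on a two-node tree the path condition is trivial.

decided-true : ∀ {A : Set} (d : Dec A) → does d ≡ true → A
decided-true (yes a) _  = a
decided-true (no _)  ()

∧-true : ∀ {a b} → a ∧ b ≡ true → a ≡ true × b ≡ true
∧-true {true} h = refl , h

∑-mono-≤ : ∀ {n} {g h : Fin n → ℕ} → (∀ i → g i ≤ h i) → sum g ≤ sum h
∑-mono-≤ {zero}  g≤h = z≤n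
∑-mono-≤ {suc n} g≤h = +-mono-≤ (g≤h Fin.zero) (∑-mono-≤ (g≤h ∘ Fin.suc))

∑-point : ∀ {n} (g : Fin n → ℕ) (c : Fin n) → (∀ i → i ≢ c → g i ≡ 0) → sum g ≡ g c
∑-point {suc n} g c vanish = begin
  sum g                                  ≡⟨ sum-remove {i = c} g ⟩
  g c + sum (λ j → g (punchIn c j))      ≡⟨ cong (g c +_) rest≡0 ⟩
  g c + 0                                ≡⟨ +-identityʳ (g c) ⟩
  g c                                    ∎
  where
  open ≡-Reasoning
  rest≡0 : sum (λ j → g (punchIn c j)) ≡ 0
  rest≡0 = trans (sum-cong-≗ (λ j → vanish (punchIn c j) (punchInᵢ≢i c j)))
                 (sum-replicate-zero n)

listSum-allFin : ∀ {A : Set} {n} (h : Fin n → A) (g : A → ℕ) →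
                 listSum (map g (List.tabulate h)) ≡ sum (g ∘ h)
listSum-allFin {n = zero}  h g = refl
listSum-allFin {n = suc n} h g = cong (g (h Fin.zero) +_) (listSum-allFin (h ∘ Fin.suc) g)

ind : Bool → ℕ
ind b = if b then 1 else 0

count : ∀ {n} → (Fin n → Bool) → ℕ
count P = sum (ind ∘ P)

pairsWhere : ∀ {n} → (Fin n → Fin n → Bool) → ℕ
pairsWhere R = sum λ i → sum λ j → ind ((toℕ i <ᵇ toℕ j) ∧ R i j)

edgeCount≡pairs : ∀ {k} (H : Graph k) → edgeCount H ≡ pairsWhere (adj H)
edgeCount≡pairs {k} H =
  trans (listSum-allFin id (λ i → listSum (map (row i) (allFin k))))
        (sum-cong-≗ (λ i → listSum-allFin id (row i)))
  where
  row : Fin k → Fin k → ℕ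
  row i j = ind ((toℕ i <ᵇ toℕ j) ∧ adj H i j)

suc-C2 : ∀ c → suc c C 2 ≡ c + c C 2
suc-C2 c = trans (≡-sym (nCk+nC[k+1]≡[n+1]C[k+1] c 1)) (cong (_+ c C 2) (nC1≡n c))

pairs-within : ∀ {n} (P : Fin n → Bool) → pairsWhere (λ i j → P i ∧ P j) ≡ count P C 2
pairs-within {zero}  P = refl
pairs-within {suc n} P = trans (cong₂ _+_ (firstRow (P Fin.zero)) (pairs-within (P ∘ Fin.suc)))
                               (byFirst (P Fin.zero))
  where
  rest : ℕ
  rest = count (P ∘ Fin.suc)
  firstRow : ∀ b → sum (λ j → ind ((0 <ᵇ toℕ j) ∧ (b ∧ P j))) ≡ (if b then rest else 0)
  firstRow true  = refl
  firstRow false = sum-replicate-zero (suc n)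
  byFirst : ∀ b → (if b then rest else 0) + rest C 2 ≡ (ind b + rest) C 2
  byFirst true  = ≡-sym (suc-C2 rest)
  byFirst false = refl

count-true : ∀ n → count {n} (λ _ → true) ≡ n
count-true zero    = refl
count-true (suc n) = cong suc (count-true n)

disjoint-indicators : ∀ l a p q → (l ≡ true → a ≡ true → p ≡ true → q ≡ true → ⊥) →
                      ind (l ∧ a) + ind (l ∧ (p ∧ q)) ≤ ind (l ∧ true)
disjoint-indicators false a     p     q     _    = z≤n
disjoint-indicators true  false false q     _    = z≤n
disjoint-indicators true  false true  false _    = z≤n
disjoint-indicators true  false true  true  _    = ≤-refl
disjoint-indicators true  true  false q     _    = ≤-refl
disjoint-indicators true  true  true  false _    = ≤-refl
disjoint-indicators true  true  true  true  all? = ⊥-elim (all? refl refl refl refl)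

independent-bound : ∀ {k} (H : Graph k) (P : Fin k → Bool) →
                    (∀ i j → adj H i j ≡ true → P i ≡ true → P j ≡ true → ⊥) →
                    edgeCount H + count P C 2 ≤ k C 2
independent-bound {k} H P independent = begin
  edgeCount H + count P C 2
    ≡⟨ cong₂ _+_ (edgeCount≡pairs H) (≡-sym (pairs-within P)) ⟩
  pairsWhere (adj H) + pairsWhere (λ i j → P i ∧ P j)
    ≡⟨ ≡-sym (∑-distrib-+ (λ i → sum (edge i)) (λ i → sum (inP i))) ⟩
  sum (λ i → sum (edge i) + sum (inP i))
    ≡⟨ sum-cong-≗ (λ i → ≡-sym (∑-distrib-+ (edge i) (inP i))) ⟩
  sum (λ i → sum (λ j → edge i j + inP i j))
    ≤⟨ ∑-mono-≤ (λ i → ∑-mono-≤ (λ j →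
         disjoint-indicators (toℕ i <ᵇ toℕ j) (adj H i j) (P i) (P j)
         (λ _ → independent i j))) ⟩
  pairsWhere {k} (λ _ _ → true)
    ≡⟨ pairs-within {k} (λ _ → true) ⟩
  count {k} (λ _ → true) C 2
    ≡⟨ cong (_C 2) (count-true k) ⟩
  k C 2 ∎
  where
  open ≤-Reasoning
  edge inP : Fin k → Fin k → ℕ
  edge i j = ind ((toℕ i <ᵇ toℕ j) ∧ adj H i j)
  inP  i j = ind ((toℕ i <ᵇ toℕ j) ∧ (P i ∧ P j))

count-classes : ∀ {k n} (f : Fin k → Fin n) (rep : Fin n → Fin k) →
                (∀ a → f (rep a) ≡ a) → (Q : Fin n → Bool) →
                count Q ≡ count (λ u → Q (f u) ∧ does (u ≟ᶠ rep (f u)))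
count-classes {k} {n} f rep section Q = begin
  sum (λ a → ind (Q a))                          ≡⟨ sum-cong-≗ (λ a → ≡-sym (byClass a)) ⟩
  sum (λ a → sum (λ u → g a u))                  ≡⟨ ∑-comm g ⟩
  sum (λ u → sum (λ a → g a u))                  ≡⟨ sum-cong-≗ byNode ⟩
  sum (λ u → ind (Q (f u) ∧ does (u ≟ᶠ rep (f u)))) ∎
  where
  open ≡-Reasoning
  g : Fin n → Fin k → ℕ
  g a u = ind (Q a ∧ does (u ≟ᶠ rep a))
  notRep : ∀ a u → u ≢ rep a → g a u ≡ 0
  notRep a u u≢ with u ≟ᶠ rep a | Q a
  ... | yes u≡ | _     = ⊥-elim (u≢ u≡)
  ... | no _   | true  = refl
  ... | no _   | false = refl
  isRep : ∀ a → g a (rep a) ≡ ind (Q a)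
  isRep a with rep a ≟ᶠ rep a | Q a
  ... | yes _ | true  = refl
  ... | yes _ | false = refl
  ... | no ≢  | _     = ⊥-elim (≢ refl)
  byClass : ∀ a → sum (g a) ≡ ind (Q a)
  byClass a = trans (∑-point (g a) (rep a) (λ u → notRep a u)) (isRep a)
  byNode : ∀ u → sum (λ a → g a u) ≡ ind (Q (f u) ∧ does (u ≟ᶠ rep (f u)))
  byNode u = ∑-point (λ a → g a u) (f u)
    (λ a a≢ → notRep a u (λ u≡ → a≢ (trans (≡-sym (section a)) (cong f (≡-sym u≡)))))

∣tabulate∣ : ∀ {n} (P : Fin n → Bool) → ∣ tabulate P ∣ ≡ count P
∣tabulate∣ {zero}  P = refl
∣tabulate∣ {suc n} P with P Fin.zero
... | true  = cong suc (∣tabulate∣ (P ∘ Fin.suc))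
... | false = ∣tabulate∣ (P ∘ Fin.suc)

twice-C2 : ∀ d → 2 * (suc d C 2) ≡ suc d * d
twice-C2 zero    = refl
twice-C2 (suc d) = begin
  2 * (suc (suc d) C 2)           ≡⟨ cong (2 *_) (suc-C2 (suc d)) ⟩
  2 * (suc d + suc d C 2)         ≡⟨ *-distribˡ-+ 2 (suc d) (suc d C 2) ⟩
  2 * suc d + 2 * (suc d C 2)     ≡⟨ cong (2 * suc d +_) (twice-C2 d) ⟩
  2 * suc d + suc d * d           ≡⟨ regroup d ⟩
  suc (suc d) * suc d             ∎
  where
  open ≡-Reasoning
  regroup : ∀ d → 2 * suc d + suc d * d ≡ suc (suc d) * suc d
  regroup = solve-∀

few-pairs⇒few-elements : ∀ c x → 2 * (c C 2) ≤ x * x → c ≤ suc x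
few-pairs⇒few-elements zero    x _ = z≤n
few-pairs⇒few-elements (suc d) x pairs≤ with d ≤? x
... | yes d≤x = s≤s d≤x
... | no  d≰x = ⊥-elim (<-irrefl refl (begin-strict
  x * x                  <⟨ *-mono-< (m<n⇒m<1+n (n<1+n x)) (n<1+n x) ⟩
  suc (suc x) * suc x    ≤⟨ *-mono-≤ (s≤s x<d) x<d ⟩
  suc d * d              ≡⟨ ≡-sym (twice-C2 d) ⟩
  2 * (suc d C 2)        ≤⟨ pairs≤ ⟩
  x * x                  ∎))
  where
  open ≤-Reasoning
  x<d : x < d
  x<d = ≰⇒> d≰x

quotAdj? : ∀ {k n} (H : Graph k) (f : Fin k → Fin n) → ∀ a b → Dec (QuotAdj H f a b)
quotAdj? H f a b = ¬? (a ≟ᶠ b) ×-dec any? λ u → any? λ v →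
  (f u ≟ᶠ a) ×-dec ((f v ≟ᶠ b) ×-dec (adj H u v ≟ᵇ true))

-- An acyclic orientation of a decidable relation is decidable: of the two
-- arcs a→b and b→a exactly one is present when {a,b} is an edge.
orientation? : ∀ {n} {E D : Fin n → Fin n → Set} → (∀ a b → Dec (E a b)) →
               IsAcyclicOrientation E D → ∀ a b → Dec (D a b)
orientation? E? (D⊆E , oriented , acyclic) a b with E? a b
... | no ¬e = no (¬e ∘ D⊆E a b)
... | yes e with oriented a b e
...   | inj₁ ab = yes ab
...   | inj₂ ba = no (λ ab → acyclic a b ab (ba ◅ []ᴿ))

source? : ∀ {n} {D : Fin n → Fin n → Set} → (∀ a b → Dec (D a b)) → ∀ a → Dec (IsSource D a)
source? D? a = all? (λ b → ¬? (D? b a))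

adjacent⇒distinct : ∀ {k} (H : Graph k) {u v} → adj H u v ≡ true → u ≢ v
adjacent⇒distinct H {u} uv refl with trans (≡-sym uv) (irrefl H u)
... | ()

adjacent-classes-not-both-sources :
  ∀ {k n} (H : Graph k) (f : Fin k → Fin n) {D : Fin n → Fin n → Set} →
  (∀ a b → QuotAdj H f a b → D a b ⊎ D b a) →
  ∀ u v → f u ≢ f v → adj H u v ≡ true → IsSource D (f u) → IsSource D (f v) → ⊥
adjacent-classes-not-both-sources H f oriented u v f≢ uv srcᵤ srcᵥ
  with oriented (f u) (f v) (f≢ , u , v , refl , refl , uv)
... | inj₁ arc = srcᵥ (f u) arc
... | inj₂ arc = srcᵤ (f v) arc

module SourceRepresentatives
  {k n} (H' : Graph k) (f : Fin k → Fin n) (surjective : Surjective _≡_ _≡_ f)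
  (D : Fin n → Fin n → Set) (orientation : IsAcyclicOrientation (QuotAdj H' f) D) where

  rep : Fin n → Fin k
  rep a = proj₁ (surjective a)

  section : ∀ a → f (rep a) ≡ a
  section a = proj₂ (surjective a) refl

  isSource? : ∀ a → Dec (IsSource D a)
  isSource? = source? (orientation? (quotAdj? H' f) orientation)

  isSource : Fin n → Bool
  isSource a = does (isSource? a)

  isSourceRep : Fin k → Bool
  isSourceRep u = isSource (f u) ∧ does (u ≟ᶠ rep (f u))

  sourceCount≡ : count isSource ≡ count isSourceRep
  sourceCount≡ = count-classes f rep section isSource

  -- Distinct representatives lie in distinct classes; so they are not
  -- adjacent in any H ⊆ H', as two adjacent classes are not both sources.
  sourceReps-independent : ∀ {H : Graph k} → H ⊆ᴱ H' →
    ∀ u v → adj H u v ≡ true → isSourceRep u ≡ true → isSourceRep v ≡ true → ⊥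
  sourceReps-independent {H} H⊆H' u v uv repᵤ repᵥ =
    adjacent-classes-not-both-sources H' f (proj₁ (proj₂ orientation)) u v
      classes-differ (H⊆H' u v uv) (sourceOf repᵤ) (sourceOf repᵥ)
    where
    sourceOf : ∀ {w} → isSourceRep w ≡ true → IsSource D (f w)
    sourceOf {w} h = decided-true (isSource? (f w)) (proj₁ (∧-true h))
    isRep : ∀ {w} → isSourceRep w ≡ true → w ≡ rep (f w)
    isRep {w} h = decided-true (w ≟ᶠ rep (f w)) (proj₂ (∧-true h))
    classes-differ : f u ≢ f v
    classes-differ fu≡fv = adjacent⇒distinct H uv
      (trans (isRep repᵤ) (trans (cong rep fu≡fv) (≡-sym (isRep repᵥ))))

split : ∀ {n} → ℕ → Subset n → Subset n × Subset n
split m       []            = [] , []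
split m       (false ∷ p)   = false ∷ proj₁ (split m p) , false ∷ proj₂ (split m p)
split zero    (true ∷ p)    = false ∷ proj₁ (split zero p) , true ∷ proj₂ (split zero p)
split (suc m) (true ∷ p)    = true ∷ proj₁ (split m p) , false ∷ proj₂ (split m p)

split₁-size : ∀ {n} m (p : Subset n) → ∣ proj₁ (split m p) ∣ ≤ m
split₁-size m       []          = z≤n
split₁-size m       (false ∷ p) = split₁-size m p
split₁-size zero    (true ∷ p)  = split₁-size zero p
split₁-size (suc m) (true ∷ p)  = s≤s (split₁-size m p)

split₂-size : ∀ {n} m (p : Subset n) → ∣ proj₂ (split m p) ∣ ≤ ∣ p ∣ ∸ m
split₂-size zero    []          = z≤n
split₂-size (suc m) []          = z≤n
split₂-size m       (false ∷ p) = split₂-size m p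
split₂-size zero    (true ∷ p)  = s≤s (split₂-size zero p)
split₂-size (suc m) (true ∷ p)  = split₂-size m p

split₁-⊆ : ∀ {n} m (p : Subset n) x → x ∈ proj₁ (split m p) → x ∈ p
split₁-⊆ m       (false ∷ p) (Fin.suc x) (there h) = there (split₁-⊆ m p x h)
split₁-⊆ zero    (true ∷ p)  Fin.zero    h         = here
split₁-⊆ zero    (true ∷ p)  (Fin.suc x) (there h) = there (split₁-⊆ zero p x h)
split₁-⊆ (suc m) (true ∷ p)  Fin.zero    h         = here
split₁-⊆ (suc m) (true ∷ p)  (Fin.suc x) (there h) = there (split₁-⊆ m p x h)

split₂-⊆ : ∀ {n} m (p : Subset n) x → x ∈ proj₂ (split m p) → x ∈ p
split₂-⊆ m       (false ∷ p) (Fin.suc x) (there h) = there (split₂-⊆ m p x h)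
split₂-⊆ zero    (true ∷ p)  Fin.zero    h         = here
split₂-⊆ zero    (true ∷ p)  (Fin.suc x) (there h) = there (split₂-⊆ zero p x h)
split₂-⊆ (suc m) (true ∷ p)  Fin.zero    h         = here
split₂-⊆ (suc m) (true ∷ p)  (Fin.suc x) (there h) = there (split₂-⊆ m p x h)

split-cover : ∀ {n} m (p : Subset n) x → x ∈ p → x ∈ proj₁ (split m p) ⊎ x ∈ proj₂ (split m p)
split-cover zero    (true ∷ p)  Fin.zero    here      = inj₂ here
split-cover (suc m) (true ∷ p)  Fin.zero    here      = inj₁ here
split-cover m       (false ∷ p) (Fin.suc x) (there h) = Data.Sum.map there there (split-cover m p x h)
split-cover zero    (true ∷ p)  (Fin.suc x) (there h) = Data.Sum.map there there (split-cover zero p x h)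
split-cover (suc m) (true ∷ p)  (Fin.suc x) (there h) = Data.Sum.map there there (split-cover m p x h)

twoNodeTree : RootedTree
twoNodeTree = record { size = 1 ; parent = λ _ → Fin.zero ; parent-lt = λ _ → z≤n }

child root : Node twoNodeTree
root  = Fin.zero
child = Fin.suc Fin.zero

child-not-above-root : ¬ AncOrSelf twoNodeTree child root
child-not-above-root ((_ , _ , ()) ◅ _)

twoNode-onPath : ∀ x y z → OnPath twoNodeTree x y z → x ≡ y ⊎ x ≡ z
twoNode-onPath Fin.zero           Fin.zero           z                  _ = inj₁ refl
twoNode-onPath (Fin.suc Fin.zero) (Fin.suc Fin.zero) z                  _ = inj₁ refl
twoNode-onPath Fin.zero           (Fin.suc Fin.zero) Fin.zero           _ = inj₂ refl
twoNode-onPath (Fin.suc Fin.zero) Fin.zero           (Fin.suc Fin.zero) _ = inj₂ refl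
twoNode-onPath Fin.zero           (Fin.suc Fin.zero) (Fin.suc Fin.zero) (_ , below) =
  ⊥-elim (child-not-above-root (below child []ᴿ []ᴿ))
twoNode-onPath (Fin.suc Fin.zero) Fin.zero           Fin.zero           (above , _) =
  ⊥-elim (child-not-above-root ([ id , id ]′ above))

-- Split the sources into a root bag of m of them and a child bag with the
-- remaining ones; the path condition is vacuous on two nodes.
twoBagDecomposition : ∀ {n} {D : Fin n → Fin n → Set} (m : ℕ) →
                      (isSource? : ∀ a → Dec (IsSource D a)) →
                      count (does ∘ isSource?) ≤ 2 * m → τ-dag≤ D m
twoBagDecomposition {n} {D} m isSource? few = decomposition , width
  where
  S : Subset n
  S = tabulate (does ∘ isSource?)

  bag : Node twoNodeTree → Subset n
  bag Fin.zero           = proj₁ (split m S)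
  bag (Fin.suc Fin.zero) = proj₂ (split m S)

  S⇒source : ∀ u → u ∈ S → IsSource D u
  S⇒source u u∈S = decided-true (isSource? u)
    (trans (≡-sym (lookup∘tabulate (does ∘ isSource?) u)) ([]=⇒lookup u∈S))

  source⇒S : ∀ u → IsSource D u → u ∈ S
  source⇒S u src = lookup⇒[]= u S (trans (lookup∘tabulate (does ∘ isSource?) u) (dec-true (isSource? u) src))

  bag⊆S : ∀ x u → u ∈ bag x → IsSource D u
  bag⊆S Fin.zero           u h = S⇒source u (split₁-⊆ m S u h)
  bag⊆S (Fin.suc Fin.zero) u h = S⇒source u (split₂-⊆ m S u h)

  S⊆⋃bags : ∀ u → IsSource D u → ∃[ x ] (u ∈ bag x)
  S⊆⋃bags u src with split-cover m S u (source⇒S u src)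
  ... | inj₁ h = root , h
  ... | inj₂ h = child , h

  path-cond : ∀ x y z → OnPath twoNodeTree x y z →
              ∀ v → InReachSet D (bag y) v → InReachSet D (bag z) v → InReachSet D (bag x) v
  path-cond x y z onPath v fromY fromZ with twoNode-onPath x y z onPath
  ... | inj₁ refl = fromY
  ... | inj₂ refl = fromZ

  decomposition : DagTreeDecomposition D
  decomposition = record { tree = twoNodeTree ; bag = bag ; bag⊆S = bag⊆S
                         ; S⊆⋃bags = S⊆⋃bags ; path-cond = path-cond }

  S-size : ∣ S ∣ ≤ m + m
  S-size = subst (∣ S ∣ ≤_) (cong (m +_) (+-identityʳ m))
                 (≤-trans (≤-reflexive (∣tabulate∣ (does ∘ isSource?))) few)

  width : width≤ decomposition m
  width Fin.zero           = split₁-size m S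
  width (Fin.suc Fin.zero) = begin
    ∣ proj₂ (split m S) ∣ ≤⟨ split₂-size m S ⟩
    ∣ S ∣ ∸ m             ≤⟨ ∸-monoˡ-≤ m S-size ⟩
    m + m ∸ m             ≡⟨ m+n∸m≡n m m ⟩
    m                     ∎
    where open ≤-Reasoning

lemma4p1 : ∀ (k : ℕ) (H : Graph k) (ε : ℕ) → edgeCount H + ε ≡ k C 2 →
           ∀ (m : ℕ) → 1 ≤ m → 2 * ε ≤ (2 * m ∸ 1) ^ 2 →
           τ-graph≤ H m
lemma4p1 k H ε missing m 1≤m ε-small H' H⊆H' n f surjective D orientation =
  twoBagDecomposition m isSource? sources≤2m
  where
  open SourceRepresentatives H' f surjective D orientation
  x : ℕ
  x = 2 * m ∸ 1

  1+x≡2m : suc x ≡ 2 * m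
  1+x≡2m = m+[n∸m]≡n (≤-trans 1≤m (m≤m+n m (m + 0)))

  -- the source representatives are independent in H, so at most ε pairs
  pairs≤ε : count isSourceRep C 2 ≤ ε
  pairs≤ε = +-cancelˡ-≤ (edgeCount H) _ _
    (subst (edgeCount H + count isSourceRep C 2 ≤_) (≡-sym missing)
           (independent-bound H isSourceRep (sourceReps-independent {H} H⊆H')))

  sources≤2m : count isSource ≤ 2 * m
  sources≤2m = subst₂ _≤_ (≡-sym sourceCount≡) 1+x≡2m
    (few-pairs⇒few-elements (count isSourceRep) x (begin
      2 * (count isSourceRep C 2) ≤⟨ *-monoʳ-≤ 2 pairs≤ε ⟩
      2 * ε                       ≤⟨ ε-small ⟩
      x ^ 2                       ≡⟨ cong (x *_) (*-identityʳ x) ⟩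
      x * x                       ∎))
    where open ≤-Reasoning
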